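{- For the game $CSG(\{1,2,4\})$ and every integer $k\ge 0$, $\mathcal{G}(S_{1,1,k})=|S_{1,1,k}| \bmod 3=(k+3)\bmod 3$.
   Context: For a set $L$ of positive integers, the game $CSG(L)$ on a connected graph $G$ is the two-player impartial game in which a move consists in removing from the current graph a connected subgraph $H$ such that $|V(H)|\in L$ and the remaining graph is connected (the empty graph counts as connected, so removing the whole graph is allowed when its size is in $L$). The player unable to move loses. $\mathcal{G}(G)$ is the Grundy value of $CSG(\{1,2,4\})$ on $G$. The subdivided star $S_{\ell_1,\ldots,\ell_t}$ is obtained from a central vertex by attaching $t$ disjoint paths with $\ell_1,\ldots,\ell_t$ vertices (paths with $0$ vertices allowed); $|G|$ is the number of vertices. -}

module Defs where

open import Data.Nat using (ℕ; zero; suc; _+_; _≡ᵇ_; _<ᵇ_)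
open import Data.Bool using (Bool; true; false; _∧_; _∨_; not; if_then_else_)
open import Data.Fin using (Fin; toℕ)
open import Data.Vec using (Vec; []; _∷_; zipWith; replicate; toList; allFin; map)
open import Data.List as List using (List; []; _∷_; _++_; filter; length)
open import Data.Bool.ListAction using (any)

record Graph : Set where
  field
    size : ℕ
    adj  : Fin size → Fin size → Bool
open Graph public

-- A vertex subset (an induced subgraph) as a characteristic vector.
VSet : ℕ → Set
VSet n = Vec Bool n

card : ∀ {n} → VSet n → ℕ
card [] = 0
card (true ∷ s) = suc (card s)
card (false ∷ s) = card s

mem : ∀ {n} → Fin n → VSet n → Bool
mem Fin.zero (b ∷ s) = b
mem (Fin.suc i) (b ∷ s) = mem i s

isEmpty : ∀ {n} → VSet n → Bool
isEmpty s = card s ≡ᵇ 0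

subsetᵇ : ∀ {n} → VSet n → VSet n → Bool
subsetᵇ [] [] = true
subsetᵇ (a ∷ s) (b ∷ t) = (not a ∨ b) ∧ subsetᵇ s t

diff : ∀ {n} → VSet n → VSet n → VSet n
diff = zipWith (λ a b → a ∧ not b)

allSubsets : (n : ℕ) → List (VSet n)
allSubsets zero = [] ∷ []
allSubsets (suc n) = List.map (true ∷_) (allSubsets n) ++ List.map (false ∷_) (allSubsets n)

firstMember : ∀ {n} → VSet n → VSet n
firstMember [] = []
firstMember (true ∷ s) = true ∷ replicate _ false
firstMember (false ∷ s) = false ∷ firstMember s

step : (G : Graph) → VSet (size G) → VSet (size G) → VSet (size G)
step G S R = map (λ v → mem v R ∨ (mem v S ∧ any (λ u → mem u R ∧ adj G u v) (toList (allFin _)))) (allFin _)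

iter : ℕ → (G : Graph) → VSet (size G) → VSet (size G) → VSet (size G)
iter zero G S R = R
iter (suc t) G S R = iter t G S (step G S R)

-- The vertices of S reachable inside G[S] from the first vertex of S.
-- (|V(G)| search steps suffice.)
reachFromFirst : (G : Graph) → VSet (size G) → VSet (size G)
reachFromFirst G S = iter (size G) G S (firstMember S)

-- G[S] is connected: S is empty (the empty graph counts as connected),
-- or every vertex of S is reachable within G[S] from one vertex of S.
connected : (G : Graph) → VSet (size G) → Bool
connected G S = isEmpty S ∨ subsetᵇ S (reachFromFirst G S)

inL : ℕ → Bool
inL m = (m ≡ᵇ 1) ∨ (m ≡ᵇ 2) ∨ (m ≡ᵇ 4)

-- Q is reachable from the position P (current graph G[P]) in one move:
-- a connected H = P \ Q with |H| ∈ {1,2,4} is removed and G[Q] is connected.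
isMove : (G : Graph) → VSet (size G) → VSet (size G) → Bool
isMove G P Q = subsetᵇ Q P ∧ inL (card (diff P Q)) ∧ connected G (diff P Q) ∧ connected G Q

options : (G : Graph) → VSet (size G) → List (VSet (size G))
options G P = filter (λ Q → Data.Bool.T? (isMove G P Q)) (allSubsets (size G))
  where import Data.Bool

elemᵇ : ℕ → List ℕ → Bool
elemᵇ m l = any (λ x → m ≡ᵇ x) l

mexGo : ℕ → ℕ → List ℕ → ℕ
mexGo zero m l = m
mexGo (suc f) m l = if elemᵇ m l then mexGo f (suc m) l else m

mex : List ℕ → ℕ
mex l = mexGo (length l) 0 l

-- Grundy value, computed with fuel; every move removes ≥ 1 vertex,
-- so fuel |V(G)| is enough to evaluate the whole game tree.
grundyF : (G : Graph) → ℕ → VSet (size G) → ℕ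
grundyF G zero P = mex []
grundyF G (suc f) P = mex (List.map (grundyF G f) (options G P))

grundy : Graph → ℕ
grundy G = grundyF G (size G) (replicate _ true)

-- Subdivided stars S_{ℓ₁,…,ℓ_t}.
-- Vertex 0 is the centre; arm i occupies the consecutive labels
-- o+1, …, o+ℓᵢ where o = ℓ₁+…+ℓ_{i-1}; the arm is a path
-- 0 – (o+1) – (o+2) – … – (o+ℓᵢ).

sumℕ : List ℕ → ℕ
sumℕ [] = 0
sumℕ (x ∷ xs) = x + sumℕ xs

armEdge : ℕ → ℕ → ℕ → ℕ → Bool
armEdge o ℓ u v =
  ((u ≡ᵇ 0) ∧ (v ≡ᵇ suc o) ∧ (0 <ᵇ ℓ))
  ∨ ((o <ᵇ u) ∧ (u <ᵇ o + ℓ) ∧ (v ≡ᵇ suc u))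

starEdge : ℕ → List ℕ → ℕ → ℕ → Bool
starEdge o [] u v = false
starEdge o (ℓ ∷ ls) u v = armEdge o ℓ u v ∨ starEdge (o + ℓ) ls u v

subdividedStar : List ℕ → Graph
subdividedStar ls = record
  { size = suc (sumℕ ls)
  ; adj  = λ u v → starEdge 0 ls (toℕ u) (toℕ v) ∨ starEdge 0 ls (toℕ v) (toℕ u)
  }

-- Every connected position P of S₁,₁,ₖ has Grundy value |P| mod 3, by induction on |P|.
-- A move removes 1, 2 or 4 vertices, none a multiple of 3, so no option has the residue
-- of P. Conversely, the residues below it are reachable: label the tree so that labels
-- increase away from the centre; then a connected P is a subtree, deleting its largest
-- label removes a leaf, and when |P| ≡ 2 the two largest labels are joined by an edge
-- (the only exception, two leaves of the central claw, forces |P| ∈ {3, 4}), so P has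
-- options with |P| − 1 and |P| − 2 vertices.

module Submission where

open import Defs
open import Data.Bool using (Bool; true; false; _∧_; _∨_; not; T; T?)
open import Data.Bool.Properties using (∧-conicalˡ; ∧-conicalʳ; ∨-zeroʳ; T-≡)
open import Data.Bool.ListAction using (any)
open import Data.Empty using (⊥)
open import Data.Fin using (Fin; toℕ; fromℕ<)
open import Data.Fin.Properties using (pigeonhole; toℕ<n; toℕ-fromℕ<)
open import Data.List as List using ([]; _∷_)
open import Data.List.Membership.Propositional using (_∈_; _∉_; lose)
open import Data.List.Membership.Propositional.Properties using (∈-map⁺; ∈-map⁻; ∈-filter⁺; ∈-filter⁻; ∈-++⁺ˡ; ∈-++⁺ʳ)
open import Data.List.Relation.Unary.Any as Any using (here; satisfied)
open import Data.List.Relation.Unary.Any.Properties using (any⁺; any⁻; lookup-index)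
open import Data.Nat using (ℕ; zero; suc; _+_; _%_; _≤_; _<_; _≮_; _≡ᵇ_; _<ᵇ_; z≤n; s≤s; _≤?_)
open import Data.Nat.DivMod using (%-distribˡ-+; m%n%n≡m%n; m%n<n)
open import Data.Nat.Properties
open import Data.Product using (∃-syntax; _×_; _,_; proj₁; proj₂)
open import Data.Sum using (_⊎_; inj₁; inj₂)
open import Data.Vec as Vec using ([]; _∷_; replicate; toList; allFin)
open import Data.Vec.Properties using (lookup-map; lookup-allFin)
open import Data.Vec.Membership.Propositional.Properties using (∈-toList⁺; ∈-allFin⁺)
open import Function using (_∘_)
open import Function.Bundles using (Equivalence)
open import Relation.Binary.PropositionalEquality
open import Relation.Nullary using (¬_; yes; no; contradiction)

open Equivalence using (to; from)

∨-true⁻ : ∀ {a b} → a ∨ b ≡ true → a ≡ true ⊎ b ≡ true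
∨-true⁻ {true} _ = inj₁ refl
∨-true⁻ {false} p = inj₂ p

true≢false : ∀ {b} → b ≡ true → b ≡ false → ⊥
true≢false refl ()

memN : ∀ {n} → ℕ → VSet n → Bool
memN i [] = false
memN zero (b ∷ s) = b
memN (suc i) (b ∷ s) = memN i s

infix 4 _∈ₛ_ _∉ₛ_

_∈ₛ_ : ∀ {n} → ℕ → VSet n → Set
i ∈ₛ S = memN i S ≡ true

_∉ₛ_ : ∀ {n} → ℕ → VSet n → Set
i ∉ₛ S = memN i S ≡ false

∉ₛ⇒¬∈ₛ : ∀ {n} i (S : VSet n) → i ∉ₛ S → ¬ i ∈ₛ S
∉ₛ⇒¬∈ₛ i S i∉ i∈ = true≢false i∈ i∉

¬∈ₛ⇒∉ₛ : ∀ {n} i (S : VSet n) → ¬ i ∈ₛ S → i ∉ₛ S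
¬∈ₛ⇒∉ₛ i S i∉ with memN i S
... | true = contradiction refl i∉
... | false = refl

mem≡memN : ∀ {n} (v : Fin n) (S : VSet n) → mem v S ≡ memN (toℕ v) S
mem≡memN Fin.zero (b ∷ S) = refl
mem≡memN (Fin.suc v) (b ∷ S) = mem≡memN v S

∈ₛ⇒< : ∀ {n} i (S : VSet n) → i ∈ₛ S → i < n
∈ₛ⇒< zero (b ∷ S) _ = s≤s z≤n
∈ₛ⇒< (suc i) (b ∷ S) p = s≤s (∈ₛ⇒< i S p)

_⊆ₛ_ : ∀ {n} → VSet n → VSet n → Set
S ⊆ₛ T = ∀ i → i ∈ₛ S → i ∈ₛ T

subsetᵇ-complete : ∀ {n} (S T : VSet n) → S ⊆ₛ T → subsetᵇ S T ≡ true
subsetᵇ-complete [] [] _ = refl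
subsetᵇ-complete (false ∷ S) (b ∷ T) h = subsetᵇ-complete S T (λ i → h (suc i))
subsetᵇ-complete (true ∷ S) (b ∷ T) h rewrite h 0 refl = subsetᵇ-complete S T (λ i → h (suc i))

subsetᵇ-sound : ∀ {n} (S T : VSet n) → subsetᵇ S T ≡ true → S ⊆ₛ T
subsetᵇ-sound (true ∷ S) (true ∷ T) _ zero _ = refl
subsetᵇ-sound (a ∷ S) (b ∷ T) p (suc i) = subsetᵇ-sound S T (∧-conicalʳ (not a ∨ b) _ p) i

memN-diff : ∀ {n} i (P Q : VSet n) → memN i (diff P Q) ≡ memN i P ∧ not (memN i Q)
memN-diff i [] [] = refl
memN-diff zero (a ∷ P) (b ∷ Q) = refl
memN-diff (suc i) (a ∷ P) (b ∷ Q) = memN-diff i P Q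

∈-diff⁺ : ∀ {n} i (P Q : VSet n) → i ∈ₛ P → i ∉ₛ Q → i ∈ₛ diff P Q
∈-diff⁺ i P Q p q rewrite memN-diff i P Q | p | q = refl

∈-diff⁻ : ∀ {n} i (P Q : VSet n) → i ∈ₛ diff P Q → i ∈ₛ P × i ∉ₛ Q
∈-diff⁻ i P Q p rewrite memN-diff i P Q with memN i P | memN i Q
... | true | false = refl , refl

card-diff : ∀ {n} (Q P : VSet n) → Q ⊆ₛ P → card Q + card (diff P Q) ≡ card P
card-diff [] [] _ = refl
card-diff (true ∷ Q) (b ∷ P) h rewrite h 0 refl = cong suc (card-diff Q P (λ i → h (suc i)))
card-diff (false ∷ Q) (true ∷ P) h = trans (+-suc (card Q) _) (cong suc (card-diff Q P (λ i → h (suc i))))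
card-diff (false ∷ Q) (false ∷ P) h = card-diff Q P (λ i → h (suc i))

card-diff≡ : ∀ {n} (Q P : VSet n) {k} → Q ⊆ₛ P → card Q + k ≡ card P → card (diff P Q) ≡ k
card-diff≡ Q P {k} Q⊆P |Q|+k = +-cancelˡ-≡ (card Q) _ k (trans (card-diff Q P Q⊆P) (sym |Q|+k))

∈ₛ⇒card≥1 : ∀ {n} i (S : VSet n) → i ∈ₛ S → 1 ≤ card S
∈ₛ⇒card≥1 zero (true ∷ S) _ = s≤s z≤n
∈ₛ⇒card≥1 (suc i) (true ∷ S) _ = s≤s z≤n
∈ₛ⇒card≥1 (suc i) (false ∷ S) p = ∈ₛ⇒card≥1 i S p

card≡0 : ∀ {n} (S : VSet n) → (∀ i → ¬ i ∈ₛ S) → card S ≡ 0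
card≡0 [] _ = refl
card≡0 (true ∷ S) h = contradiction refl (h 0)
card≡0 (false ∷ S) h = card≡0 S (λ i → h (suc i))

card-bounded : ∀ {n} (S : VSet n) b → (∀ i → i ∈ₛ S → i < b) → card S ≤ b
card-bounded [] b _ = z≤n
card-bounded (true ∷ S) zero h with h 0 refl
... | ()
card-bounded (false ∷ S) zero h = card-bounded S 0 (λ i p → contradiction (h (suc i) p) λ ())
card-bounded (x ∷ S) (suc b) h = ≤-trans (head-card x) (s≤s (card-bounded S b (λ i p → ≤-pred (h (suc i) p))))
  where
  head-card : ∀ x → card (x ∷ S) ≤ suc (card S)
  head-card true = ≤-refl
  head-card false = n≤1+n _

del : ∀ {n} → ℕ → VSet n → VSet n
del m [] = []
del zero (b ∷ s) = false ∷ s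
del (suc m) (b ∷ s) = b ∷ del m s

∈-del⁺ : ∀ {n} i m (S : VSet n) → i ∈ₛ S → i ≢ m → i ∈ₛ del m S
∈-del⁺ zero zero (b ∷ S) _ i≢m = contradiction refl i≢m
∈-del⁺ zero (suc m) (b ∷ S) p _ = p
∈-del⁺ (suc i) zero (b ∷ S) p _ = p
∈-del⁺ (suc i) (suc m) (b ∷ S) p i≢m = ∈-del⁺ i m S p (i≢m ∘ cong suc)

∈-del⁻ : ∀ {n} i m (S : VSet n) → i ∈ₛ del m S → i ∈ₛ S × i ≢ m
∈-del⁻ zero (suc m) (b ∷ S) p = p , λ ()
∈-del⁻ (suc i) zero (b ∷ S) p = p , λ ()
∈-del⁻ (suc i) (suc m) (b ∷ S) p = proj₁ rec , proj₂ rec ∘ suc-injective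
  where rec = ∈-del⁻ i m S p

∉-del : ∀ {n} m (S : VSet n) → m ∉ₛ del m S
∉-del m S = ¬∈ₛ⇒∉ₛ m (del m S) (λ p → proj₂ (∈-del⁻ m m S p) refl)

del⊆ : ∀ {n} m (S : VSet n) → del m S ⊆ₛ S
del⊆ m S i i∈ = proj₁ (∈-del⁻ i m S i∈)

∉-del⇒≡ : ∀ {n} i m (S : VSet n) → i ∈ₛ S → i ∉ₛ del m S → i ≡ m
∉-del⇒≡ i m S i∈S i∉ with i ≟ m
... | yes i≡m = i≡m
... | no i≢m = contradiction (∈-del⁺ i m S i∈S i≢m) (∉ₛ⇒¬∈ₛ i (del m S) i∉)

card-del : ∀ {n} m (S : VSet n) → m ∈ₛ S → card (del m S) + 1 ≡ card S
card-del zero (true ∷ S) _ = +-comm (card S) 1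
card-del (suc m) (true ∷ S) p = cong suc (card-del m S p)
card-del (suc m) (false ∷ S) p = card-del m S p

card-del₂ : ∀ {n} m₁ m₂ (S : VSet n) → m₁ ∈ₛ S → m₂ ∈ₛ del m₁ S → card (del m₂ (del m₁ S)) + 2 ≡ card S
card-del₂ m₁ m₂ S m₁∈S m₂∈ = begin
  card (del m₂ (del m₁ S)) + 2      ≡⟨ +-assoc (card (del m₂ (del m₁ S))) 1 1 ⟨
  card (del m₂ (del m₁ S)) + 1 + 1  ≡⟨ cong (_+ 1) (card-del m₂ (del m₁ S) m₂∈) ⟩
  card (del m₁ S) + 1               ≡⟨ card-del m₁ S m₁∈S ⟩
  card S                            ∎
  where open ≡-Reasoning

card-full : ∀ n → card (replicate n true) ≡ n
card-full zero = refl
card-full (suc n) = cong suc (card-full n)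

∈-full : ∀ {n} i → i < n → i ∈ₛ replicate n true
∈-full {suc n} zero _ = refl
∈-full {suc n} (suc i) (s≤s i<n) = ∈-full {n} i i<n

IsMin IsMax : ∀ {n} → ℕ → VSet n → Set
IsMin r S = r ∈ₛ S × (∀ i → i ∈ₛ S → r ≤ i)
IsMax m S = m ∈ₛ S × (∀ i → i ∈ₛ S → i ≤ m)

single : ∀ {n} → ℕ → VSet n
single {zero} m = []
single {suc n} zero = true ∷ replicate _ false
single {suc n} (suc m) = false ∷ single m

∈-single⁻ : ∀ {n} i m → i ∈ₛ single {n} m → i ≡ m
∈-single⁻ {suc n} zero zero _ = refl
∈-single⁻ {suc n} (suc i) zero p = contradiction p (∉ₛ⇒¬∈ₛ i (replicate n false) (∉-replicate n i))
  where
  ∉-replicate : ∀ n i → i ∉ₛ replicate n false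
  ∉-replicate zero i = refl
  ∉-replicate (suc n) zero = refl
  ∉-replicate (suc n) (suc i) = ∉-replicate n i
∈-single⁻ {suc n} (suc i) (suc m) p = cong suc (∈-single⁻ {n} i m p)

∈-single⁺ : ∀ {n} m → m < n → m ∈ₛ single {n} m
∈-single⁺ {suc n} zero _ = refl
∈-single⁺ {suc n} (suc m) (s≤s m<n) = ∈-single⁺ {n} m m<n

firstMember≡single-min : ∀ {n} (S : VSet n) → 1 ≤ card S →
  ∃[ r ] IsMin r S × firstMember S ≡ single r
firstMember≡single-min (true ∷ S) _ = 0 , (refl , λ _ _ → z≤n) , refl
firstMember≡single-min (false ∷ S) p with firstMember≡single-min S p
... | r , (r∈S , r≤) , eq = suc r , (r∈S , ≤-suc) , cong (false ∷_) eq
  where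
  ≤-suc : ∀ i → i ∈ₛ (false ∷ S) → suc r ≤ i
  ≤-suc (suc i) q = s≤s (r≤ i q)

max-exists : ∀ {n} (S : VSet n) → 1 ≤ card S → ∃[ m ] IsMax m S
max-exists (b ∷ S) p with 1 ≤? card S
... | yes q with max-exists S q
...   | m , m∈S , ≤m = suc m , m∈S , ≤suc
  where
  ≤suc : ∀ i → i ∈ₛ (b ∷ S) → i ≤ suc m
  ≤suc zero _ = z≤n
  ≤suc (suc i) r = s≤s (≤m i r)
max-exists (true ∷ S) p | no q = 0 , refl , ≤0
  where
  ≤0 : ∀ i → i ∈ₛ (true ∷ S) → i ≤ 0
  ≤0 zero _ = z≤n
  ≤0 (suc i) r = contradiction (∈ₛ⇒card≥1 i S r) q
max-exists (false ∷ S) p | no q = contradiction p q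

-- Minimum excludant

elemᵇ-sound : ∀ x l → T (elemᵇ x l) → x ∈ l
elemᵇ-sound x l p = Any.map (≡ᵇ⇒≡ x _) (any⁻ _ l p)

elemᵇ-complete : ∀ x l → x ∈ l → T (elemᵇ x l)
elemᵇ-complete x l p = any⁺ _ (Any.map (λ { refl → ≡⇒≡ᵇ x x refl }) p)

mexGo-≡ : ∀ d f m l → d ≤ f → (∀ w → w < d → m + w ∈ l) → m + d ∉ l → mexGo f m l ≡ m + d
mexGo-≡ zero zero m l _ _ _ = sym (+-identityʳ m)
mexGo-≡ zero (suc f) m l _ _ m∉l with elemᵇ m l in eq
... | true = contradiction (subst (_∈ l) (sym (+-identityʳ m)) (elemᵇ-sound m l (from T-≡ eq))) m∉l
... | false = sym (+-identityʳ m)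
mexGo-≡ (suc d) (suc f) m l (s≤s d≤f) below m+d∉l with elemᵇ m l in eq
... | false = contradiction (elemᵇ-complete m l m∈l) (λ m∈ → true≢false (to T-≡ m∈) eq)
  where
  m∈l : m ∈ l
  m∈l = subst (_∈ l) (+-identityʳ m) (below 0 (s≤s z≤n))
... | true = trans (mexGo-≡ d f (suc m) l d≤f below′ (subst (_∉ l) (+-suc m d) m+d∉l)) (sym (+-suc m d))
  where
  below′ : ∀ w → w < d → suc m + w ∈ l
  below′ w w<d = subst (_∈ l) (+-suc m w) (below (suc w) (s≤s w<d))

-- The fuel length l of mex suffices: 0, …, v − 1 sit at distinct positions of l.
mex-≡ : ∀ l v → (∀ w → w < v → w ∈ l) → v ∉ l → mex l ≡ v
mex-≡ l v below v∉l = mexGo-≡ v (List.length l) 0 l v≤length below v∉l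
  where
  position : (w : Fin v) → toℕ w ∈ l
  position w = below (toℕ w) (toℕ<n w)

  v≤length : v ≤ List.length l
  v≤length with v ≤? List.length l
  ... | yes v≤ = v≤
  ... | no v≰ with pigeonhole (≰⇒> v≰) (Any.index ∘ position)
  ...   | i , j , i<j , same = contradiction (begin
          toℕ i                                  ≡⟨ lookup-index (position i) ⟩
          List.lookup l (Any.index (position i)) ≡⟨ cong (List.lookup l) same ⟩
          List.lookup l (Any.index (position j)) ≡⟨ lookup-index (position j) ⟨
          toℕ j                                  ∎) (<⇒≢ i<j)
    where open ≡-Reasoning

-- Residues mod 3

%3-+ : ∀ q h → (q + h) % 3 ≡ (q % 3 + h) % 3
%3-+ q h = begin
  (q + h) % 3             ≡⟨ %-distribˡ-+ q h 3 ⟩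
  (q % 3 + h % 3) % 3     ≡⟨ cong (λ x → (x + h % 3) % 3) (m%n%n≡m%n q 3) ⟨
  (q % 3 % 3 + h % 3) % 3 ≡⟨ %-distribˡ-+ (q % 3) h 3 ⟨
  (q % 3 + h) % 3         ∎
  where open ≡-Reasoning

move-size-changes-residue : ∀ q h → inL h ≡ true → (q + h) % 3 ≢ q % 3
move-size-changes-residue q h h∈L e = changes (q % 3) h (m%n<n q 3) h∈L (trans (sym (%3-+ q h)) e)
  where
  changes : ∀ r h → r < 3 → inL h ≡ true → (r + h) % 3 ≢ r
  changes 0 1 _ _ ()
  changes 0 2 _ _ ()
  changes 0 4 _ _ ()
  changes 1 1 _ _ ()
  changes 1 2 _ _ ()
  changes 1 4 _ _ ()
  changes 2 1 _ _ ()
  changes 2 2 _ _ ()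
  changes 2 4 _ _ ()
  changes (suc (suc (suc _))) _ (s≤s (s≤s (s≤s ()))) _
  changes _ 0 _ ()
  changes _ 3 _ ()
  changes _ (suc (suc (suc (suc (suc _))))) _ ()

residue-of-+1 : ∀ q w → (q + 1) % 3 ≡ suc w → q % 3 ≡ w
residue-of-+1 q w e = pred (q % 3) w (m%n<n q 3) (trans (sym (%3-+ q 1)) e)
  where
  pred : ∀ r w → r < 3 → (r + 1) % 3 ≡ suc w → r ≡ w
  pred 0 .0 _ refl = refl
  pred 1 .1 _ refl = refl
  pred 2 w _ ()
  pred (suc (suc (suc _))) _ (s≤s (s≤s (s≤s ()))) _

residue-of-+2 : ∀ q → (q + 2) % 3 ≡ 2 → q % 3 ≡ 0
residue-of-+2 q e = residue-of-+1 q 0 (residue-of-+1 (q + 1) 1 (subst (λ x → x % 3 ≡ 2) (sym (+-assoc q 1 1)) e))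

-- The game CSG({1,2,4})

∈-allSubsets : ∀ {n} (Q : VSet n) → Q ∈ allSubsets n
∈-allSubsets [] = here refl
∈-allSubsets {suc n} (true ∷ Q) = ∈-++⁺ˡ (∈-map⁺ (true ∷_) (∈-allSubsets Q))
∈-allSubsets {suc n} (false ∷ Q) = ∈-++⁺ʳ (List.map (true ∷_) (allSubsets n)) (∈-map⁺ (false ∷_) (∈-allSubsets Q))

module _ (G : Graph) where

  ∈-options⁺ : ∀ P Q → isMove G P Q ≡ true → Q ∈ options G P
  ∈-options⁺ P Q mv = ∈-filter⁺ (λ Q → T? (isMove G P Q)) (∈-allSubsets Q) (from T-≡ mv)

  ∈-options⁻ : ∀ P Q → Q ∈ options G P → isMove G P Q ≡ true
  ∈-options⁻ P Q m = to T-≡ (proj₂ (∈-filter⁻ (λ Q → T? (isMove G P Q)) {xs = allSubsets (size G)} m))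

  isMove-intro : ∀ P Q → Q ⊆ₛ P → inL (card (diff P Q)) ≡ true →
    connected G (diff P Q) ≡ true → connected G Q ≡ true → isMove G P Q ≡ true
  isMove-intro P Q Q⊆P size∈L removed-conn rest-conn
    rewrite subsetᵇ-complete Q P Q⊆P | size∈L | removed-conn | rest-conn = refl

  isMove-elim : ∀ P Q → isMove G P Q ≡ true →
    connected G Q ≡ true × inL (card (diff P Q)) ≡ true × card Q + card (diff P Q) ≡ card P
  isMove-elim P Q mv = rest-conn , size∈L , card-diff Q P (subsetᵇ-sound Q P Q⊆P)
    where
    Q⊆P = ∧-conicalˡ (subsetᵇ Q P) _ mv
    others = ∧-conicalʳ (subsetᵇ Q P) _ mv
    size∈L = ∧-conicalˡ (inL (card (diff P Q))) _ others
    rest-conn = ∧-conicalʳ (connected G (diff P Q)) _ (∧-conicalʳ (inL (card (diff P Q))) _ others)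

  module _
    (remove-one : ∀ P → connected G P ≡ true → 1 ≤ card P →
       ∃[ Q ] isMove G P Q ≡ true × card Q + 1 ≡ card P)
    (remove-two : ∀ P → connected G P ≡ true → card P % 3 ≡ 2 →
       ∃[ Q ] isMove G P Q ≡ true × card Q + 2 ≡ card P)
    where

    grundyF≡card%3 : ∀ f P → connected G P ≡ true → card P ≤ f → grundyF G f P ≡ card P % 3
    grundyF≡card%3 zero P _ |P|≤0 rewrite n≤0⇒n≡0 |P|≤0 = refl
    grundyF≡card%3 (suc f) P P-conn |P|≤1+f = mex-≡ values (card P % 3) reached missed
      where
      values = List.map (grundyF G f) (options G P)

      option-value : ∀ Q → isMove G P Q ≡ true → grundyF G f Q ≡ card Q % 3
      option-value Q mv with isMove-elim P Q mv
      ... | Q-conn , size∈L , |Q|+h≡|P| = grundyF≡card%3 f Q Q-conn (≤-pred (begin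
        suc (card Q)                  ≡⟨ +-comm 1 (card Q) ⟩
        card Q + 1                    ≤⟨ +-monoʳ-≤ (card Q) (size∈L⇒1≤ _ size∈L) ⟩
        card Q + card (diff P Q)      ≡⟨ |Q|+h≡|P| ⟩
        card P                        ≤⟨ |P|≤1+f ⟩
        suc f                         ∎))
        where
        open ≤-Reasoning
        size∈L⇒1≤ : ∀ h → inL h ≡ true → 1 ≤ h
        size∈L⇒1≤ (suc h) _ = s≤s z≤n

      missed : card P % 3 ∉ values
      missed v∈ with ∈-map⁻ (grundyF G f) v∈
      ... | Q , Q∈ , e with ∈-options⁻ P Q Q∈
      ... | mv with isMove-elim P Q mv
      ... | _ , size∈L , |Q|+h≡|P| = move-size-changes-residue (card Q) _ size∈L
            (trans (cong (_% 3) |Q|+h≡|P|) (trans e (option-value Q mv)))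

      value-of : ∀ Q → isMove G P Q ≡ true → grundyF G f Q ∈ values
      value-of Q mv = ∈-map⁺ (grundyF G f) (∈-options⁺ P Q mv)

      reached-by : ∀ w Q → isMove G P Q ≡ true → card Q % 3 ≡ w → w ∈ values
      reached-by w Q mv e = subst (_∈ values) (trans (option-value Q mv) e) (value-of Q mv)

      nonempty : ∀ c → card P % 3 ≡ suc c → 1 ≤ card P
      nonempty c e with card P
      ... | suc _ = s≤s z≤n

      reached : ∀ w → w < card P % 3 → w ∈ values
      reached w w< with card P % 3 in e | m%n<n (card P) 3
      reached 0 _ | 1 | _ with remove-one P P-conn (nonempty 0 e)
      ... | Q , mv , |Q|+1 = reached-by 0 Q mv (residue-of-+1 (card Q) 0 (trans (cong (_% 3) |Q|+1) e))
      reached 1 _ | 2 | _ with remove-one P P-conn (nonempty 1 e)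
      ... | Q , mv , |Q|+1 = reached-by 1 Q mv (residue-of-+1 (card Q) 1 (trans (cong (_% 3) |Q|+1) e))
      reached 0 _ | 2 | _ with remove-two P P-conn e
      ... | Q , mv , |Q|+2 = reached-by 0 Q mv (residue-of-+2 (card Q) (trans (cong (_% 3) |Q|+2) e))
      reached _ () | 0 | _
      reached (suc (suc _)) (s≤s (s≤s ())) | 2 | _
      reached (suc _) (s≤s ()) | 1 | _
      reached _ _ | suc (suc (suc _)) | s≤s (s≤s (s≤s ()))

-- Graph search

module _ (G : Graph) where

  Adjacent : ℕ → ℕ → Set
  Adjacent i j = ∃[ u ] ∃[ v ] toℕ u ≡ i × toℕ v ≡ j × adj G u v ≡ true

  private
    fin-of : ∀ {i} → i < size G → ∃[ v ] toℕ v ≡ i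
    fin-of i< = fromℕ< i< , toℕ-fromℕ< i<

    mem≡lookup : ∀ {m} (v : Fin m) (S : VSet m) → mem v S ≡ Vec.lookup S v
    mem≡lookup Fin.zero (b ∷ S) = refl
    mem≡lookup (Fin.suc v) (b ∷ S) = mem≡lookup v S

  hasNeighbourIn : VSet (size G) → Fin (size G) → Bool
  hasNeighbourIn R v = any (λ u → mem u R ∧ adj G u v) (toList (allFin (size G)))

  memN-step : ∀ (S R : VSet (size G)) (v : Fin (size G)) →
    memN (toℕ v) (step G S R) ≡ memN (toℕ v) R ∨ (memN (toℕ v) S ∧ hasNeighbourIn R v)
  memN-step S R v = begin
    memN (toℕ v) (step G S R)                         ≡⟨ mem≡memN v _ ⟨
    mem v (step G S R)                                ≡⟨ mem≡lookup v _ ⟩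
    Vec.lookup (step G S R) v                         ≡⟨ lookup-map v _ (allFin (size G)) ⟩
    step-at (Vec.lookup (allFin (size G)) v)          ≡⟨ cong step-at (lookup-allFin v) ⟩
    mem v R ∨ (mem v S ∧ hasNeighbourIn R v)          ≡⟨ cong₂ (λ a b → a ∨ (b ∧ hasNeighbourIn R v)) (mem≡memN v R) (mem≡memN v S) ⟩
    memN (toℕ v) R ∨ (memN (toℕ v) S ∧ hasNeighbourIn R v) ∎
    where
    open ≡-Reasoning
    step-at : Fin (size G) → Bool
    step-at w = mem w R ∨ (mem w S ∧ hasNeighbourIn R w)

  ∈-step⁺ˡ : ∀ (S R : VSet (size G)) i → i ∈ₛ R → i ∈ₛ step G S R
  ∈-step⁺ˡ S R i i∈R with fin-of (∈ₛ⇒< i R i∈R)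
  ... | v , refl rewrite memN-step S R v | i∈R = refl

  private
    neighbour-in : ∀ (R : VSet (size G)) (u v : Fin (size G)) → toℕ u ∈ₛ R → adj G u v ≡ true →
      hasNeighbourIn R v ≡ true
    neighbour-in R u v u∈R uv = to T-≡ (any⁺ _ (lose (∈-toList⁺ (∈-allFin⁺ u)) u-edge))
      where
      u-edge : T (mem u R ∧ adj G u v)
      u-edge rewrite mem≡memN u R | u∈R | uv = _

  ∈-step⁺ʳ : ∀ (S R : VSet (size G)) i j → i ∈ₛ S → j ∈ₛ R → Adjacent j i → i ∈ₛ step G S R
  ∈-step⁺ʳ S R .(toℕ v) .(toℕ u) i∈S j∈R (u , v , refl , refl , uv)
    rewrite memN-step S R v | i∈S | neighbour-in R u v j∈R uv = ∨-zeroʳ _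

  ∈-step⁻ : ∀ (S R : VSet (size G)) i → i ∈ₛ step G S R → i ∈ₛ R ⊎ (i ∈ₛ S × ∃[ j ] j ∈ₛ R × Adjacent j i)
  ∈-step⁻ S R i i∈ with fin-of (∈ₛ⇒< i (step G S R) i∈)
  ... | v , refl rewrite memN-step S R v with ∨-true⁻ {memN (toℕ v) R} i∈
  ...   | inj₁ i∈R = inj₁ i∈R
  ...   | inj₂ found
    with satisfied (any⁻ (λ u → mem u R ∧ adj G u v) (toList (allFin (size G)))
                         (from T-≡ (∧-conicalʳ (memN (toℕ v) S) _ found)))
  ...     | u , u-edge = inj₂ (∧-conicalˡ _ _ found , toℕ u , u∈R , u , v , refl , refl , uv)
    where
    u-edge′ = to T-≡ u-edge
    u∈R = trans (sym (mem≡memN u R)) (∧-conicalˡ (mem u R) _ u-edge′)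
    uv = ∧-conicalʳ (mem u R) _ u-edge′

  iter-suc : ∀ t (S R : VSet (size G)) → iter (suc t) G S R ≡ step G S (iter t G S R)
  iter-suc zero S R = refl
  iter-suc (suc t) S R = iter-suc t S (step G S R)

  iter-preserves : ∀ (S : VSet (size G)) (Inv : VSet (size G) → Set) → (∀ R → Inv R → Inv (step G S R)) →
    ∀ t R → Inv R → Inv (iter t G S R)
  iter-preserves S Inv preserved zero R inv = inv
  iter-preserves S Inv preserved (suc t) R inv = iter-preserves S Inv preserved t (step G S R) (preserved R inv)

  ∈-iter⁺ : ∀ t (S R : VSet (size G)) i → i ∈ₛ R → i ∈ₛ iter t G S R
  ∈-iter⁺ t S R i = iter-preserves S (i ∈ₛ_) (λ R′ → ∈-step⁺ˡ S R′ i) t R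

  connected-empty : ∀ (S : VSet (size G)) → card S ≡ 0 → connected G S ≡ true
  connected-empty S e rewrite e = refl

  private
    firstMember≡single : ∀ r (S : VSet (size G)) → IsMin r S → firstMember S ≡ single r
    firstMember≡single r S (r∈S , r≤) with firstMember≡single-min S (∈ₛ⇒card≥1 r S r∈S)
    ... | r′ , (r′∈S , r′≤) , eq = trans eq (cong single (≤-antisym (r′≤ r r∈S) (r≤ r′ r′∈S)))

    isEmpty-false : ∀ r (S : VSet (size G)) → r ∈ₛ S → isEmpty S ≡ false
    isEmpty-false r S r∈S with card S | ∈ₛ⇒card≥1 r S r∈S
    ... | suc _ | _ = refl

  connected≡reaches-from-min : ∀ r (S : VSet (size G)) → IsMin r S →
    connected G S ≡ subsetᵇ S (iter (size G) G S (single r))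
  connected≡reaches-from-min r S min = begin
    connected G S                            ≡⟨ cong (_∨ subsetᵇ S (reachFromFirst G S)) (isEmpty-false r S (proj₁ min)) ⟩
    subsetᵇ S (reachFromFirst G S)           ≡⟨ cong (λ X → subsetᵇ S (iter (size G) G S X)) (firstMember≡single r S min) ⟩
    subsetᵇ S (iter (size G) G S (single r)) ∎
    where open ≡-Reasoning

  connected-intro : ∀ r (S : VSet (size G)) → IsMin r S → S ⊆ₛ iter (size G) G S (single r) → connected G S ≡ true
  connected-intro r S min reached =
    trans (connected≡reaches-from-min r S min) (subsetᵇ-complete S _ reached)

  connected-elim : ∀ r (S : VSet (size G)) → IsMin r S → connected G S ≡ true → S ⊆ₛ iter (size G) G S (single r)
  connected-elim r S min conn = subsetᵇ-sound S _ (trans (sym (connected≡reaches-from-min r S min)) conn)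

-- Rooted trees

module RootedTree (G : Graph) (parent : ℕ → ℕ)
  (parent-< : ∀ i → 1 ≤ i → parent i < i)
  (adjacent⇒parent : ∀ i j → Adjacent G i j → (1 ≤ j × i ≡ parent j) ⊎ (1 ≤ i × j ≡ parent i))
  (parent-adjacent : ∀ j → 1 ≤ j → j < size G → Adjacent G (parent j) j)
  where

  V : Set
  V = VSet (size G)

  record Subtree (r : ℕ) (S : V) : Set where
    field
      root-min : IsMin r S
      parent-closed : ∀ i → i ∈ₛ S → r < i → parent i ∈ₛ S

  subtree⇒connected : ∀ r S → Subtree r S → connected G S ≡ true
  subtree⇒connected r S T = connected-intro G r S root-min (λ i i∈S → reach (size G) i i∈S (<⇒≤ (∈ₛ⇒< i S i∈S)))
    where
    open Subtree T
    reach : ∀ t i → i ∈ₛ S → i ≤ t → i ∈ₛ iter t G S (single r)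
    reach t i i∈S i≤t with m≤n⇒m<n∨m≡n (proj₂ root-min i i∈S)
    ... | inj₂ refl = ∈-iter⁺ G t S (single r) r (∈-single⁺ r (∈ₛ⇒< r S i∈S))
    reach zero i i∈S i≤0 | inj₁ r<i = contradiction (≤-trans r<i i≤0) λ ()
    reach (suc t) i i∈S (s≤s i≤t) | inj₁ r<i =
      subst (i ∈ₛ_) (sym (iter-suc G t S (single r)))
        (∈-step⁺ʳ G S _ i (parent i) i∈S
          (reach t (parent i) (parent-closed i i∈S r<i) (≤-pred (≤-trans (parent-< i 1≤i) (s≤s i≤t))))
          (parent-adjacent i 1≤i (∈ₛ⇒< i S i∈S)))
      where
      1≤i = ≤-trans (s≤s z≤n) r<i

  connected⇒subtree : ∀ S → connected G S ≡ true → 1 ≤ card S → ∃[ r ] Subtree r S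
  connected⇒subtree S conn nonempty with firstMember≡single-min S nonempty
  ... | r , min@(r∈S , r≤) , _ = r , record { root-min = min ; parent-closed = closed }
    where
    Closed : V → Set
    Closed R = R ⊆ₛ S × (∀ i → i ∈ₛ R → r < i → parent i ∈ₛ R)

    found-via-parent : ∀ R → Closed R → ∀ i → i ∈ₛ step G S R → i ∈ₛ R ⊎ (i ∈ₛ S × parent i ∈ₛ R)
    found-via-parent R (R⊆S , R-closed) i i∈ with ∈-step⁻ G S R i i∈
    ... | inj₁ i∈R = inj₁ i∈R
    ... | inj₂ (i∈S , j , j∈R , j~i) with adjacent⇒parent j i j~i
    ...   | inj₁ (_ , refl) = inj₂ (i∈S , j∈R)
    ...   | inj₂ (1≤j , refl) = inj₁ (R-closed j j∈R (≤-<-trans (r≤ (parent j) i∈S) (parent-< j 1≤j)))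

    closed-step : ∀ R → Closed R → Closed (step G S R)
    closed-step R cl@(R⊆S , R-closed) = step⊆S , step-closed
      where
      step⊆S : step G S R ⊆ₛ S
      step⊆S i i∈ with found-via-parent R cl i i∈
      ... | inj₁ i∈R = R⊆S i i∈R
      ... | inj₂ (i∈S , _) = i∈S
      step-closed : ∀ i → i ∈ₛ step G S R → r < i → parent i ∈ₛ step G S R
      step-closed i i∈ r<i with found-via-parent R cl i i∈
      ... | inj₁ i∈R = ∈-step⁺ˡ G S R (parent i) (R-closed i i∈R r<i)
      ... | inj₂ (_ , p∈R) = ∈-step⁺ˡ G S R (parent i) p∈R

    closed-start : Closed (single r)
    closed-start = (λ i i∈ → subst (_∈ₛ S) (sym (∈-single⁻ {size G} i r i∈)) r∈S)
                 , (λ i i∈ r<i → contradiction (∈-single⁻ {size G} i r i∈) (≢-sym (<⇒≢ r<i)))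

    reached = iter-preserves G S Closed closed-step (size G) (single r) closed-start

    closed : ∀ i → i ∈ₛ S → r < i → parent i ∈ₛ S
    closed i i∈S r<i = proj₁ reached (parent i) (proj₂ reached i (connected-elim G r S min conn i i∈S) r<i)

  children-subtree : ∀ r S → r ∈ₛ S → (∀ i → i ∈ₛ S → i ≡ r ⊎ (r < i × parent i ≡ r)) → Subtree r S
  children-subtree r S r∈S members = record { root-min = r∈S , r≤ ; parent-closed = closed }
    where
    r≤ : ∀ i → i ∈ₛ S → r ≤ i
    r≤ i i∈S with members i i∈S
    ... | inj₁ refl = ≤-refl
    ... | inj₂ (r<i , _) = <⇒≤ r<i
    closed : ∀ i → i ∈ₛ S → r < i → parent i ∈ₛ S
    closed i i∈S r<i with members i i∈S
    ... | inj₁ refl = contradiction r<i (<-irrefl refl)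
    ... | inj₂ (_ , refl) = r∈S

  del-max-connected : ∀ P m → connected G P ≡ true → IsMax m P → connected G (del m P) ≡ true
  del-max-connected P m conn (m∈P , ≤m) with connected⇒subtree P conn (∈ₛ⇒card≥1 m P m∈P)
  ... | r , T with r ≟ m
  ...   | yes refl = connected-empty G (del m P) (card≡0 (del m P) only-root)
    where
    open Subtree T
    only-root : ∀ i → ¬ i ∈ₛ del m P
    only-root i i∈ with ∈-del⁻ i m P i∈
    ... | i∈P , i≢m = i≢m (≤-antisym (≤m i i∈P) (proj₂ root-min i i∈P))
  ...   | no r≢m = subtree⇒connected r (del m P) (record
    { root-min = ∈-del⁺ r m P (proj₁ root-min) r≢m , λ i i∈ → proj₂ root-min i (del⊆ m P i i∈)
    ; parent-closed = λ i i∈ r<i → ∈-del⁺ (parent i) m P (parent-closed i (del⊆ m P i i∈) r<i)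
        (<⇒≢ (<-≤-trans (parent-< i (≤-trans (s≤s z≤n) r<i)) (≤m i (del⊆ m P i i∈)))) })
    where open Subtree T

  remove-max : ∀ P → connected G P ≡ true → 1 ≤ card P →
    ∃[ Q ] isMove G P Q ≡ true × card Q + 1 ≡ card P
  remove-max P conn nonempty with max-exists P nonempty
  ... | m , max@(m∈P , _) = Q , isMove-intro G P Q (del⊆ m P) size∈L removed-conn (del-max-connected P m conn max) , |Q|+1
    where
    Q = del m P
    |Q|+1 = card-del m P m∈P
    size∈L : inL (card (diff P Q)) ≡ true
    size∈L rewrite card-diff≡ Q P (del⊆ m P) |Q|+1 = refl
    removed-conn : connected G (diff P Q) ≡ true
    removed-conn = subtree⇒connected m (diff P Q) (children-subtree m (diff P Q)
      (∈-diff⁺ m P Q m∈P (∉-del m P))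
      λ i i∈ → inj₁ (∉-del⇒≡ i m P (proj₁ (∈-diff⁻ i P Q i∈)) (proj₂ (∈-diff⁻ i P Q i∈))))

  remove-two-largest : ∀ P m₁ m₂ → connected G P ≡ true → IsMax m₁ P → IsMax m₂ (del m₁ P) → parent m₁ ≡ m₂ →
    isMove G P (del m₂ (del m₁ P)) ≡ true × card (del m₂ (del m₁ P)) + 2 ≡ card P
  remove-two-largest P m₁ m₂ conn max₁@(m₁∈P , ≤m₁) max₂@(m₂∈Q₁ , _) parent≡ =
    isMove-intro G P Q Q⊆P size∈L removed-conn (del-max-connected Q₁ m₂ (del-max-connected P m₁ conn max₁) max₂) , |Q|+2
    where
    Q₁ = del m₁ P
    Q = del m₂ Q₁
    Q⊆P : Q ⊆ₛ P
    Q⊆P i i∈ = del⊆ m₁ P i (del⊆ m₂ Q₁ i i∈)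
    |Q|+2 = card-del₂ m₁ m₂ P m₁∈P m₂∈Q₁
    size∈L : inL (card (diff P Q)) ≡ true
    size∈L rewrite card-diff≡ Q P Q⊆P |Q|+2 = refl
    m₂∈P = del⊆ m₁ P m₂ m₂∈Q₁
    m₂<m₁ : m₂ < m₁
    m₂<m₁ = ≤∧≢⇒< (≤m₁ m₂ m₂∈P) (proj₂ (∈-del⁻ m₂ m₁ P m₂∈Q₁))
    removed : ∀ i → i ∈ₛ diff P Q → i ≡ m₂ ⊎ (m₂ < i × parent i ≡ m₂)
    removed i i∈ with ∈-diff⁻ i P Q i∈
    ... | i∈P , i∉Q with memN i Q₁ in i-in-Q₁
    ...   | true = inj₁ (∉-del⇒≡ i m₂ Q₁ i-in-Q₁ i∉Q)
    ...   | false with ∉-del⇒≡ i m₁ P i∈P i-in-Q₁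
    ...     | refl = inj₂ (m₂<m₁ , parent≡)
    removed-conn : connected G (diff P Q) ≡ true
    removed-conn = subtree⇒connected m₂ (diff P Q) (children-subtree m₂ (diff P Q)
      (∈-diff⁺ m₂ P Q m₂∈P (∉-del m₂ Q₁)) removed)

star₁₁ : ℕ → Graph
star₁₁ k = subdividedStar (1 ∷ 1 ∷ k ∷ [])

-- subdividedStar labels the centre 0, the two leaves 1 and 2, and the long arm 3, …, k + 2.
starParent : ℕ → ℕ
starParent (suc (suc (suc (suc i)))) = suc (suc (suc i))
starParent _ = 0

starParent-< : ∀ i → 1 ≤ i → starParent i < i
starParent-< 1 _ = s≤s z≤n
starParent-< 2 _ = s≤s z≤n
starParent-< 3 _ = s≤s z≤n
starParent-< (suc (suc (suc (suc i)))) _ = ≤-refl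

module _ (k : ℕ) where

  private
    arm : ℕ → ℕ → Bool
    arm = starEdge 0 (1 ∷ 1 ∷ k ∷ [])

    arm⇒parent : ∀ a b → arm a b ≡ true → 1 ≤ b × a ≡ starParent b
    arm⇒parent 0 1 _ = s≤s z≤n , refl
    arm⇒parent 0 2 _ = s≤s z≤n , refl
    arm⇒parent 0 3 _ = s≤s z≤n , refl
    arm⇒parent (suc (suc (suc a))) b p with ∨-true⁻ {(suc a <ᵇ k) ∧ (b ≡ᵇ suc (suc (suc (suc a))))} p
    ... | inj₁ q rewrite ≡ᵇ⇒≡ b _ (from T-≡ (∧-conicalʳ (suc a <ᵇ k) _ q)) = s≤s z≤n , refl

    parent-arm : ∀ b → 1 ≤ b → b < 3 + k → arm (starParent b) b ≡ true
    parent-arm 1 _ _ = refl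
    parent-arm 2 _ _ = refl
    parent-arm 3 _ (s≤s (s≤s (s≤s 0<k))) rewrite to T-≡ (<⇒<ᵇ 0<k) = refl
    parent-arm (suc (suc (suc (suc b)))) _ (s≤s (s≤s (s≤s (s≤s b<k))))
      rewrite to T-≡ (<⇒<ᵇ b<k) | to T-≡ (≡⇒≡ᵇ b b refl) = refl

    3+k≡size : 3 + k ≡ size (star₁₁ k)
    3+k≡size = cong (3 +_) (sym (+-identityʳ k))

  star-adjacent⇒parent : ∀ i j → Adjacent (star₁₁ k) i j →
    (1 ≤ j × i ≡ starParent j) ⊎ (1 ≤ i × j ≡ starParent i)
  star-adjacent⇒parent _ _ (u , v , refl , refl , uv) with ∨-true⁻ {arm (toℕ u) (toℕ v)} uv
  ... | inj₁ u→v = inj₁ (arm⇒parent _ _ u→v)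
  ... | inj₂ v→u = inj₂ (arm⇒parent _ _ v→u)

  star-parent-adjacent : ∀ j → 1 ≤ j → j < size (star₁₁ k) → Adjacent (star₁₁ k) (starParent j) j
  star-parent-adjacent j 1≤j j< = fromℕ< p< , fromℕ< j< , toℕ-fromℕ< p< , toℕ-fromℕ< j< , edge
    where
    p< = <-trans (starParent-< j 1≤j) j<
    edge : adj (star₁₁ k) (fromℕ< p<) (fromℕ< j<) ≡ true
    edge rewrite toℕ-fromℕ< p< | toℕ-fromℕ< j< | parent-arm j 1≤j (subst (j <_) (sym 3+k≡size) j<) = refl

  open RootedTree (star₁₁ k) starParent starParent-< star-adjacent⇒parent star-parent-adjacent

  private
    starParent-gap : ∀ i j → starParent i < j → j < i → i ≤ 3
    starParent-gap 0 _ _ _ = z≤n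
    starParent-gap 1 _ _ _ = s≤s z≤n
    starParent-gap 2 _ _ _ = s≤s (s≤s z≤n)
    starParent-gap 3 _ _ _ = s≤s (s≤s (s≤s z≤n))
    starParent-gap (suc (suc (suc (suc i)))) j p<j j<i = contradiction p<j (<⇒≱ j<i)

    c%3≡2⇒2≤c : ∀ c → c % 3 ≡ 2 → 2 ≤ c
    c%3≡2⇒2≤c (suc (suc _)) _ = s≤s (s≤s z≤n)

    3≤c≤4⇒c%3≢2 : ∀ c → 3 ≤ c → c ≤ 4 → c % 3 ≢ 2
    3≤c≤4⇒c%3≢2 2 (s≤s (s≤s ()))
    3≤c≤4⇒c%3≢2 3 _ _ ()
    3≤c≤4⇒c%3≢2 4 _ _ ()
    3≤c≤4⇒c%3≢2 (suc (suc (suc (suc (suc _))))) _ (s≤s (s≤s (s≤s (s≤s ()))))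

  second-largest-is-parent : ∀ P m₁ m₂ → connected (star₁₁ k) P ≡ true →
    IsMax m₁ P → IsMax m₂ (del m₁ P) → card P % 3 ≡ 2 → starParent m₁ ≡ m₂
  second-largest-is-parent P m₁ m₂ conn (m₁∈P , ≤m₁) (m₂∈Q₁ , ≤m₂) |P|%3≡2
    with connected⇒subtree P conn (∈ₛ⇒card≥1 m₁ P m₁∈P)
  ... | r , T = ≤∧≮⇒≡ p≤m₂ too-small
    where
    open Subtree T
    m₂∈P = del⊆ m₁ P m₂ m₂∈Q₁
    m₂<m₁ = ≤∧≢⇒< (≤m₁ m₂ m₂∈P) (proj₂ (∈-del⁻ m₂ m₁ P m₂∈Q₁))
    r<m₁ = ≤-<-trans (proj₂ root-min m₂ m₂∈P) m₂<m₁
    p<m₁ = starParent-< m₁ (≤-trans (s≤s z≤n) r<m₁)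
    p∈Q₁ = ∈-del⁺ (starParent m₁) m₁ P (parent-closed m₁ m₁∈P r<m₁) (<⇒≢ p<m₁)
    p≤m₂ = ≤m₂ (starParent m₁) p∈Q₁

    -- Otherwise m₁ and m₂ are two of the leaves 1, 2, 3 of the claw, so P ⊆ {0, …, 3}.
    too-small : starParent m₁ ≮ m₂
    too-small p<m₂ = 3≤c≤4⇒c%3≢2 (card P) 3≤|P| |P|≤4 |P|%3≡2
      where
      m₁≤3 = starParent-gap m₁ m₂ p<m₂ m₂<m₁
      |P|≤4 = card-bounded P 4 (λ i i∈P → s≤s (≤-trans (≤m₁ i i∈P) m₁≤3))
      p∈Q₂ = ∈-del⁺ (starParent m₁) m₂ (del m₁ P) p∈Q₁ (<⇒≢ p<m₂)
      3≤|P| : 3 ≤ card P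
      3≤|P| = begin
        3                             ≤⟨ +-monoˡ-≤ 2 (∈ₛ⇒card≥1 (starParent m₁) (del m₂ (del m₁ P)) p∈Q₂) ⟩
        card (del m₂ (del m₁ P)) + 2  ≡⟨ card-del₂ m₁ m₂ P m₁∈P m₂∈Q₁ ⟩
        card P                        ∎
        where open ≤-Reasoning

  star-remove-two : ∀ P → connected (star₁₁ k) P ≡ true → card P % 3 ≡ 2 →
    ∃[ Q ] isMove (star₁₁ k) P Q ≡ true × card Q + 2 ≡ card P
  star-remove-two P conn |P|%3≡2 with max-exists P (≤-trans (s≤s z≤n) (c%3≡2⇒2≤c (card P) |P|%3≡2))
  ... | m₁ , max₁@(m₁∈P , _) with max-exists (del m₁ P) Q₁-nonempty
    where
    Q₁-nonempty : 1 ≤ card (del m₁ P)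
    Q₁-nonempty = +-cancelʳ-≤ 1 1 (card (del m₁ P)) (subst (2 ≤_) (sym (card-del m₁ P m₁∈P)) (c%3≡2⇒2≤c (card P) |P|%3≡2))
  ...   | m₂ , max₂ = del m₂ (del m₁ P) ,
          remove-two-largest P m₁ m₂ conn max₁ max₂ (second-largest-is-parent P m₁ m₂ conn max₁ max₂ |P|%3≡2)

  star-grundyF : ∀ f P → connected (star₁₁ k) P ≡ true → card P ≤ f → grundyF (star₁₁ k) f P ≡ card P % 3
  star-grundyF = grundyF≡card%3 (star₁₁ k) remove-max star-remove-two

  star-full-connected : connected (star₁₁ k) (replicate (size (star₁₁ k)) true) ≡ true
  star-full-connected = subtree⇒connected 0 full (record
    { root-min = refl , λ _ _ → z≤n
    ; parent-closed = λ i i∈ 0<i → ∈-full (starParent i) (<-trans (starParent-< i 0<i) (∈ₛ⇒< i full i∈)) })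
    where full = replicate (size (star₁₁ k)) true

lemma21 : (k : ℕ) →
    (grundy (subdividedStar (1 ∷ 1 ∷ k ∷ [])) ≡ size (subdividedStar (1 ∷ 1 ∷ k ∷ [])) % 3)
    × (size (subdividedStar (1 ∷ 1 ∷ k ∷ [])) % 3 ≡ (k + 3) % 3)
lemma21 k = grundy≡size%3 , cong (_% 3) size≡k+3
  where
  n = size (star₁₁ k)
  full = replicate n true

  grundy≡size%3 : grundy (star₁₁ k) ≡ n % 3
  grundy≡size%3 = begin
    grundyF (star₁₁ k) n full ≡⟨ star-grundyF k n full (star-full-connected k) (≤-reflexive (card-full n)) ⟩
    card full % 3             ≡⟨ cong (_% 3) (card-full n) ⟩
    n % 3                     ∎
    where open ≡-Reasoning

  size≡k+3 : n ≡ k + 3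
  size≡k+3 = trans (cong (3 +_) (+-identityʳ k)) (+-comm 3 k)
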